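{- Let $k$ be an indeterminate, let $\mu$ be the Möbius function, and let $n>1$ be an integer. Then each of the following products equals $k^m$ for some positive integer $m$: (1) $\prod_{d\mid n}\left(k^{2^d-d-1}\right)^{\mu(n/d)}$; (2) $\prod_{d\mid n}\left(k^{2^d-1}\right)^{\mu(n/d)}$; (3) $\prod_{d\mid n}\left(k^{2^{d-1}}\right)^{\mu(n/d)}$; (4) $\prod_{d\mid n}\left(k^{b(d)}\right)^{\mu(n/d)}$, where $b(d)=\left\lceil \frac{2(2^{d-1}-1)}{3}\right\rceil$.
   Context: Products are over the positive divisors $d$ of $n$. -}

module Defs where

open import Data.Bool using (Bool; if_then_else_)
open import Data.Nat using (ℕ; zero; suc; _+_; _*_; _∸_; _^_; _/_)
open import Data.Nat.Divisibility using (_∣_; _∣?_)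
open import Data.Nat.Primality using (Prime; prime?)
open import Data.Integer using (ℤ; +_; -_) renaming (_+_ to _+ᶻ_; _*_ to _*ᶻ_; _^_ to _^ᶻ'_)
open import Data.List using (List; upTo; filter; map; foldr; length)
open import Data.Bool.ListAction using (any)
open import Relation.Nullary.Decidable using (does; _×-dec_)

range1 : ℕ → List ℕ
range1 n = map suc (upTo n)

primeDivisors : ℕ → List ℕ
primeDivisors n = filter (λ p → prime? p ×-dec (p ∣? n)) (range1 n)

μ : ℕ → ℤ
μ n = if any (λ p → does (p * p ∣? n)) (primeDivisors n)
        then + 0
        else (- (+ 1)) ^ᶻ' length (primeDivisors n)

-- Laurent monomials in a single indeterminate k: k^z with z ∈ ℤ.
-- This is the (free abelian) multiplicative group generated by k.
record LMono : Set where
  constructor k^_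
  field exp : ℤ

infixl 7 _·_
_·_ : LMono → LMono → LMono
(k^ a) · (k^ b) = k^ (a +ᶻ b)

one : LMono
one = k^ (+ 0)

infixr 8 _^ᵐ_
_^ᵐ_ : LMono → ℤ → LMono
(k^ a) ^ᵐ z = k^ (a *ᶻ z)

-- Positive divisors d of n, listed in increasing order.
-- We represent d as suc i so that n / d is well defined.
divisorPreds : ℕ → List ℕ
divisorPreds n = filter (λ i → suc i ∣? n) (upTo n)

möbiusProd : (ℕ → ℕ) → ℕ → LMono
möbiusProd e n =
  foldr _·_ one (map (λ i → (k^ (+ e (suc i))) ^ᵐ μ (n / suc i)) (divisorPreds n))

-- The four exponent functions.  All subtractions are exact for d ≥ 1
-- (2^d ≥ d + 1, 2^(d-1) ≥ 1), so truncated ∸ agrees with integer subtraction.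
e₁ e₂ e₃ b : ℕ → ℕ
e₁ d = 2 ^ d ∸ d ∸ 1
e₂ d = 2 ^ d ∸ 1
e₃ d = 2 ^ (d ∸ 1)
-- b(d) = ⌈ 2(2^{d-1} - 1) / 3 ⌉ = ⌊ (2(2^{d-1} - 1) + 2) / 3 ⌋
b d = (2 * (2 ^ (d ∸ 1) ∸ 1) + 2) / 3

{-# OPTIONS --safe #-}
-- The product is k raised to e-hat(n) = Σ_{d ∣ n} e(d) μ(n/d).  The divisor d = n contributes
-- e(n), while each proper divisor contributes at least −e(d) because μ ≥ −1.  All four exponent
-- functions satisfy e(1) < e(2) and 2 e(d) ≤ e(d+1), hence are superincreasing:
-- e(n) > e(1) + ⋯ + e(n−1).  So e-hat(n) ≥ e(n) − Σ_{d<n} e(d) ≥ 1.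
module Submission where

open import Defs
open import Data.Bool using (true; false)
open import Data.Bool.ListAction using (any)
open import Data.Integer
  using (ℤ; +_; -_; 0ℤ; 1ℤ; -1ℤ; -≤+; +≤+)
  renaming (_+_ to _+ᶻ_; _*_ to _*ᶻ_; _^_ to _^ᶻ_; _≤_ to _≤ᶻ_)
import Data.Integer.Properties as ℤ
open import Data.List using (List; []; _∷_; _++_; [_]; filter; map; foldr; upTo; length)
open import Data.List.Properties using (filter-++; filter-accept; map-++; upTo-∷ʳ)
open import Data.Nat using (ℕ; zero; suc; _+_; _*_; _∸_; _^_; _/_; _≤_; _<_; z≤n; s≤s; NonZero)
import Data.Nat.Properties as ℕ
open import Data.Nat.DivMod using (n/n≡1; m*n/n≡m; m/n*n≤m; /-monoˡ-≤)
open import Data.Nat.Divisibility using (_∣?_; ∣-refl)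
open import Data.Nat.ListAction using (sum)
open import Data.Nat.ListAction.Properties using (sum-++)
open import Data.Product using (_×_; ∃; _,_)
open import Data.Sum using (_⊎_; inj₁; inj₂)
open import Function using (_∘_)
open import Relation.Nullary.Decidable using (does)
open import Level using (0ℓ)
open import Relation.Unary using (Pred; Decidable)
open import Relation.Binary.PropositionalEquality
  using (_≡_; refl; sym; trans; cong; subst; module ≡-Reasoning)

sumᶻ : List ℤ → ℤ
sumᶻ = foldr _+ᶻ_ 0ℤ

sumᶻ-++ : ∀ xs ys → sumᶻ (xs ++ ys) ≡ sumᶻ xs +ᶻ sumᶻ ys
sumᶻ-++ []       ys = sym (ℤ.+-identityˡ (sumᶻ ys))
sumᶻ-++ (x ∷ xs) ys =
  trans (cong (x +ᶻ_) (sumᶻ-++ xs ys)) (sym (ℤ.+-assoc x (sumᶻ xs) (sumᶻ ys)))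

foldr-·-k^ : ∀ {A : Set} (f : A → ℤ) xs →
             foldr _·_ one (map (λ x → k^ (f x)) xs) ≡ k^ (sumᶻ (map f xs))
foldr-·-k^ f []       = refl
foldr-·-k^ f (x ∷ xs) = cong (k^ (f x) ·_) (foldr-·-k^ f xs)

-‿+ : ∀ m n → - (+ (m + n)) ≡ - (+ m) +ᶻ - (+ n)
-‿+ m n = trans (cong -_ (ℤ.pos-+ m n)) (ℤ.neg-distrib-+ (+ m) (+ n))

module _ {A : Set} {P : Pred A 0ℓ} (P? : Decidable P) (f : A → ℤ) (g : A → ℕ)
         (-g≤f : ∀ x → - (+ g x) ≤ᶻ f x) where

  sumᶻ-filter-≥ : ∀ xs → - (+ sum (map g xs)) ≤ᶻ sumᶻ (map f (filter P? xs))
  sumᶻ-filter-≥ []       = ℤ.≤-refl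
  sumᶻ-filter-≥ (x ∷ xs) with does (P? x)
  ... | true  = subst (_≤ᶻ f x +ᶻ sumᶻ (map f (filter P? xs)))
                  (sym (-‿+ (g x) (sum (map g xs))))
                  (ℤ.+-mono-≤ (-g≤f x) (sumᶻ-filter-≥ xs))
  ... | false = ℤ.≤-trans (ℤ.neg-mono-≤ (+≤+ (ℕ.m≤n+m (sum (map g xs)) (g x))))
                          (sumᶻ-filter-≥ xs)

[-1]^n≡±1 : ∀ n → -1ℤ ^ᶻ n ≡ 1ℤ ⊎ -1ℤ ^ᶻ n ≡ -1ℤ
[-1]^n≡±1 zero = inj₁ refl
[-1]^n≡±1 (suc n) with [-1]^n≡±1 n
... | inj₁ eq = inj₂ (cong (-1ℤ *ᶻ_) eq)
... | inj₂ eq = inj₁ (cong (-1ℤ *ᶻ_) eq)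

-1≤μ : ∀ n → -1ℤ ≤ᶻ μ n
-1≤μ n with any (λ p → does (p * p ∣? n)) (primeDivisors n)
... | true  = -≤+
... | false with [-1]^n≡±1 (length (primeDivisors n))
...   | inj₁ eq = subst (-1ℤ ≤ᶻ_) (sym eq) -≤+
...   | inj₂ eq = subst (-1ℤ ≤ᶻ_) (sym eq) ℤ.≤-refl

-a≤a*μ : ∀ a n → - (+ a) ≤ᶻ + a *ᶻ μ n
-a≤a*μ a n = subst (_≤ᶻ + a *ᶻ μ n) (trans (ℤ.*-comm (+ a) -1ℤ) (ℤ.-1*i≡-i (+ a)))
                   (ℤ.*-monoˡ-≤-nonNeg (+ a) (-1≤μ n))

divisorPreds-suc : ∀ m → divisorPreds (suc m) ≡ filter (λ i → suc i ∣? suc m) (upTo m) ++ [ m ]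
divisorPreds-suc m = begin
  filter P? (upTo (suc m))               ≡⟨ cong (filter P?) (upTo-∷ʳ m) ⟨
  filter P? (upTo m ++ [ m ])            ≡⟨ filter-++ P? (upTo m) [ m ] ⟩
  filter P? (upTo m) ++ filter P? [ m ]  ≡⟨ cong (filter P? (upTo m) ++_) (filter-accept P? ∣-refl) ⟩
  filter P? (upTo m) ++ [ m ]            ∎
  where
  open ≡-Reasoning
  P? = λ i → suc i ∣? suc m

möbiusTerm : (ℕ → ℕ) → ℕ → ℕ → ℤ
möbiusTerm e n i = + e (suc i) *ᶻ μ (n / suc i)

möbiusExponent : (ℕ → ℕ) → ℕ → ℤ
möbiusExponent e n = sumᶻ (map (möbiusTerm e n) (divisorPreds n))

möbiusProd≡k^möbiusExponent : ∀ e n → möbiusProd e n ≡ k^ (möbiusExponent e n)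
möbiusProd≡k^möbiusExponent e n = foldr-·-k^ (möbiusTerm e n) (divisorPreds n)

möbiusTerm-self : ∀ e m → möbiusTerm e (suc m) m ≡ + e (suc m)
möbiusTerm-self e m =
  trans (cong (λ q → + e (suc m) *ᶻ μ q) (n/n≡1 (suc m))) (ℤ.*-identityʳ (+ e (suc m)))

möbiusExponent-suc : ∀ e m →
  möbiusExponent e (suc m) ≡
  sumᶻ (map (möbiusTerm e (suc m)) (filter (λ i → suc i ∣? suc m) (upTo m))) +ᶻ + e (suc m)
möbiusExponent-suc e m = begin
  sumᶻ (map t (divisorPreds (suc m)))  ≡⟨ cong (sumᶻ ∘ map t) (divisorPreds-suc m) ⟩
  sumᶻ (map t (ds ++ [ m ]))           ≡⟨ cong sumᶻ (map-++ t ds [ m ]) ⟩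
  sumᶻ (map t ds ++ [ t m ])           ≡⟨ sumᶻ-++ (map t ds) [ t m ] ⟩
  sumᶻ (map t ds) +ᶻ (t m +ᶻ 0ℤ)       ≡⟨ cong (sumᶻ (map t ds) +ᶻ_) (ℤ.+-identityʳ (t m)) ⟩
  sumᶻ (map t ds) +ᶻ t m               ≡⟨ cong (sumᶻ (map t ds) +ᶻ_) (möbiusTerm-self e m) ⟩
  sumᶻ (map t ds) +ᶻ + e (suc m)       ∎
  where
  open ≡-Reasoning
  t  = möbiusTerm e (suc m)
  ds = filter (λ i → suc i ∣? suc m) (upTo m)

partialSum : (ℕ → ℕ) → ℕ → ℕ
partialSum e m = sum (map (λ i → e (suc i)) (upTo m))

partialSum-suc : ∀ e m → partialSum e (suc m) ≡ partialSum e m + e (suc m)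
partialSum-suc e m = begin
  sum (map g (upTo (suc m)))        ≡⟨ cong (sum ∘ map g) (upTo-∷ʳ m) ⟨
  sum (map g (upTo m ++ [ m ]))     ≡⟨ cong sum (map-++ g (upTo m) [ m ]) ⟩
  sum (map g (upTo m) ++ [ g m ])   ≡⟨ sum-++ (map g (upTo m)) [ g m ] ⟩
  partialSum e m + (g m + 0)        ≡⟨ cong (λ v → partialSum e m + v) (ℕ.+-identityʳ (g m)) ⟩
  partialSum e m + g m              ∎
  where
  open ≡-Reasoning
  g = λ i → e (suc i)

möbiusExponent-≥ : ∀ e m → - (+ partialSum e m) +ᶻ + e (suc m) ≤ᶻ möbiusExponent e (suc m)
möbiusExponent-≥ e m =
  subst (- (+ partialSum e m) +ᶻ + e (suc m) ≤ᶻ_) (sym (möbiusExponent-suc e m))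
    (ℤ.+-monoˡ-≤ (+ e (suc m))
      (sumᶻ-filter-≥ (λ i → suc i ∣? suc m) (möbiusTerm e (suc m)) (λ i → e (suc i))
                     (λ i → -a≤a*μ (e (suc i)) (suc m / suc i)) (upTo m)))

Superincreasing : (ℕ → ℕ) → Set
Superincreasing e = ∀ m → partialSum e (suc m) < e (suc (suc m))

doubling⇒superincreasing : ∀ e → e 1 < e 2 → (∀ d → 2 * e (suc d) ≤ e (suc (suc d))) →
                           Superincreasing e
doubling⇒superincreasing e e₁<e₂ doubling zero =
  subst (_< e 2) (sym (ℕ.+-identityʳ (e 1))) e₁<e₂
doubling⇒superincreasing e e₁<e₂ doubling (suc m) = begin-strict
  partialSum e (suc (suc m))     ≡⟨ partialSum-suc e (suc m) ⟩
  partialSum e (suc m) + E       <⟨ ℕ.+-monoˡ-< E (doubling⇒superincreasing e e₁<e₂ doubling m) ⟩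
  E + E                          ≡⟨ cong (λ v → E + v) (ℕ.+-identityʳ E) ⟨
  2 * E                          ≤⟨ doubling (suc m) ⟩
  e (suc (suc (suc m)))          ∎
  where
  open ℕ.≤-Reasoning
  E = e (suc (suc m))

möbiusExponent-positive : ∀ e → Superincreasing e → ∀ m → 1ℤ ≤ᶻ möbiusExponent e (suc (suc m))
möbiusExponent-positive e sup m = begin
  1ℤ               ≤⟨ +≤+ (ℕ.m<n⇒0<n∸m (sup m)) ⟩
  + (E ∸ S)        ≡⟨ trans (ℤ.-m+n≡n⊖m S E) (ℤ.⊖-≥ (ℕ.<⇒≤ (sup m))) ⟨
  - (+ S) +ᶻ + E   ≤⟨ möbiusExponent-≥ e (suc m) ⟩
  möbiusExponent e (suc (suc m)) ∎
  where
  open ℤ.≤-Reasoning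
  S = partialSum e (suc m)
  E = e (suc (suc m))

1≤i⇒i≡+q : ∀ {i} → 1ℤ ≤ᶻ i → ∃ λ q → 0 < q × i ≡ + q
1≤i⇒i≡+q (+≤+ {n = suc q} _) = suc q , s≤s z≤n , refl

superincreasing⇒möbiusProd≡k^+ : ∀ e → Superincreasing e →
  ∀ n → 1 < n → ∃ λ q → 0 < q × möbiusProd e n ≡ k^ (+ q)
superincreasing⇒möbiusProd≡k^+ e sup (suc (suc m)) (s≤s (s≤s _))
  with 1≤i⇒i≡+q (möbiusExponent-positive e sup m)
... | q , 0<q , eq = q , 0<q , trans (möbiusProd≡k^möbiusExponent e (suc (suc m))) (cong k^_ eq)

2*[m∸n]≤2*m∸o : ∀ m n {o} → o ≤ 2 * n → 2 * (m ∸ n) ≤ 2 * m ∸ o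
2*[m∸n]≤2*m∸o m n {o} o≤2n =
  subst (_≤ 2 * m ∸ o) (sym (ℕ.*-distribˡ-∸ 2 m n)) (ℕ.∸-monoʳ-≤ (2 * m) o≤2n)

m*[n/o]≤m*n/o : ∀ m n o .{{_ : NonZero o}} → m * (n / o) ≤ m * n / o
m*[n/o]≤m*n/o m n o = begin
  m * (n / o)             ≡⟨ m*n/n≡m (m * (n / o)) o ⟨
  m * (n / o) * o / o     ≤⟨ /-monoˡ-≤ o (begin
    m * (n / o) * o         ≡⟨ ℕ.*-assoc m (n / o) o ⟩
    m * (n / o * o)         ≤⟨ ℕ.*-monoʳ-≤ m (m/n*n≤m n o) ⟩
    m * n                   ∎) ⟩
  m * n / o               ∎
  where open ℕ.≤-Reasoning

e₁-doubling : ∀ d → 2 * e₁ (suc d) ≤ e₁ (suc (suc d))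
e₁-doubling d = begin
  2 * e₁ (suc d)              ≡⟨ cong (2 *_) (ℕ.∸-+-assoc x (suc d) 1) ⟩
  2 * (x ∸ (suc d + 1))       ≤⟨ 2*[m∸n]≤2*m∸o x (suc d + 1) (ℕ.+-mono-≤ (s≤s z≤n) (ℕ.m≤m+n (suc d + 1) 0)) ⟩
  2 * x ∸ (suc (suc d) + 1)   ≡⟨ ℕ.∸-+-assoc (2 * x) (suc (suc d)) 1 ⟨
  e₁ (suc (suc d))            ∎
  where
  open ℕ.≤-Reasoning
  x = 2 ^ suc d

e₂-doubling : ∀ d → 2 * e₂ (suc d) ≤ e₂ (suc (suc d))
e₂-doubling d = 2*[m∸n]≤2*m∸o (2 ^ suc d) 1 (s≤s z≤n)

e₃-doubling : ∀ d → 2 * e₃ (suc d) ≤ e₃ (suc (suc d))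
e₃-doubling d = ℕ.≤-refl

b-suc : ∀ d → b (suc d) ≡ 2 ^ suc d / 3
b-suc d = cong (_/ 3)
  (trans (sym (ℕ.*-distribˡ-+ 2 (2 ^ d ∸ 1) 1)) (cong (2 *_) (ℕ.m∸n+n≡m (ℕ.m^n>0 2 d))))

b-doubling : ∀ d → 2 * b (suc d) ≤ b (suc (suc d))
b-doubling d = begin
  2 * b (suc d)          ≡⟨ cong (2 *_) (b-suc d) ⟩
  2 * (2 ^ suc d / 3)    ≤⟨ m*[n/o]≤m*n/o 2 (2 ^ suc d) 3 ⟩
  2 ^ suc (suc d) / 3    ≡⟨ b-suc (suc d) ⟨
  b (suc (suc d))        ∎
  where open ℕ.≤-Reasoning

lemma3p2 : (n : ℕ) → 1 < n →
    (∃ λ m → 0 < m × möbiusProd e₁ n ≡ k^ (+ m)) ×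
    (∃ λ m → 0 < m × möbiusProd e₂ n ≡ k^ (+ m)) ×
    (∃ λ m → 0 < m × möbiusProd e₃ n ≡ k^ (+ m)) ×
    (∃ λ m → 0 < m × möbiusProd b n ≡ k^ (+ m))
lemma3p2 n 1<n =
  positive e₁ (doubling⇒superincreasing e₁ (s≤s z≤n)       e₁-doubling) ,
  positive e₂ (doubling⇒superincreasing e₂ (s≤s (s≤s z≤n)) e₂-doubling) ,
  positive e₃ (doubling⇒superincreasing e₃ (s≤s (s≤s z≤n)) e₃-doubling) ,
  positive b  (doubling⇒superincreasing b  (s≤s z≤n)       b-doubling)
  where
  positive : ∀ e → Superincreasing e → ∃ λ m → 0 < m × möbiusProd e n ≡ k^ (+ m)
  positive e sup = superincreasing⇒möbiusProd≡k^+ e sup n 1<n
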